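{- Let $p,q,r$ be integers, $n\ge0$ an integer, and $x$ a number with $(1+x-x^2)(1-4x-x^2)\neq0$. Then $$\begin{aligned}\sum_{k=0}^n x^kG_{p+k}H_{q+k}K_{r+k}=\frac{1}{(1+x-x^2)(1-4x-x^2)}\Big\{&x^{n+1}\big[x^2(x+3)G_{p+n}H_{q+n}K_{r+n}+(3x-1)G_{p+n+1}H_{q+n+1}K_{r+n+1}\\&\quad+x^2G_{p+n-1}H_{q+n-1}K_{r+n-1}-xG_{p+n+2}H_{q+n+2}K_{r+n+2}\big]\\&-x^2(x+3)G_{p-1}H_{q-1}K_{r-1}-(3x-1)G_pH_qK_r\\&-x^2G_{p-2}H_{q-2}K_{r-2}+xG_{p+1}H_{q+1}K_{r+1}\Big\}.\end{aligned}$$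
   Context: $(G_n),(H_n),(K_n)$, indexed by all integers $n$, are generalized Fibonacci sequences: each satisfies $X_{n+2}=X_{n+1}+X_n$ for all integers $n$, with arbitrary initial values $X_0,X_1$. -}

module Defs where

open import Level using (Level)
open import Algebra.Bundles using (CommutativeRing)
open import Data.Nat using (ℕ; zero; suc)
open import Data.Integer using (ℤ; +_)
import Data.Integer as ℤ

IsGenFib : ∀ {c ℓ} (R : CommutativeRing c ℓ) → (ℤ → CommutativeRing.Carrier R) → Set ℓ
IsGenFib R X = ∀ (n : ℤ) → X (n ℤ.+ + 2) ≈ X (n ℤ.+ + 1) + X n
  where open CommutativeRing R

pow : ∀ {c ℓ} (R : CommutativeRing c ℓ) → CommutativeRing.Carrier R → ℕ → CommutativeRing.Carrier R
pow R x zero = CommutativeRing.1# R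
pow R x (suc k) = CommutativeRing._*_ R x (pow R x k)

sumTo : ∀ {c ℓ} (R : CommutativeRing c ℓ) → (ℕ → CommutativeRing.Carrier R) → ℕ → CommutativeRing.Carrier R
sumTo R f zero = f zero
sumTo R f (suc n) = CommutativeRing._+_ R (sumTo R f n) (f (suc n))

-- The product T i = G i H i K i of three solutions of X (n+2) = X (n+1) + X n is a linear
-- combination of α³, α²β = -α, αβ² = -β and β³ (α, β the roots of t² = t + 1), so it satisfies
-- the recurrence with characteristic polynomial (t² - 4t - 1)(t² + t - 1) = t⁴ - 3t³ - 6t² + 3t + 1.
-- The denominator (1 + x - x²)(1 - 4x - x²) is the reciprocal of that polynomial, and the
-- recurrence is exactly what makes  D(x) T i = x B i - B (i - 1)  for the boundary expression B
-- in the bracket; multiplying by x^i, the weighted sum telescopes.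
module Submission where

open import Defs

open import Algebra.Bundles using (Ring; CommutativeRing)
open import Data.Nat as ℕ using (ℕ; zero; suc)
open import Data.Integer using (ℤ; +_; -[1+_])
import Data.Integer as ℤ
import Data.Integer.Properties as ℤP
import Data.Nat.Properties as ℕP
import Data.Sign as Sign
open import Data.Maybe using (Maybe; just; nothing)
open import Function using (_∘_)
open import Relation.Nullary using (yes; no)
open import Relation.Binary.PropositionalEquality as ≡ using (_≡_)
open import Data.Integer.Tactic.RingSolver using (solve-∀)

module FromInteger {c ℓ} (R : Ring c ℓ) where
  open Ring R
  open import Algebra.Properties.Ring R
  open import Algebra.Properties.AbelianGroup +-abelianGroup using (⁻¹-∙-comm)
  open import Algebra.Properties.Semiring.Mult.TCOptimised semiring
  open import Relation.Binary.Reasoning.Setoid setoid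

  fromℤ : ℤ → Carrier
  fromℤ (+ n)    = n × 1#
  fromℤ -[1+ n ] = - (suc n × 1#)

  suc×1# : ∀ n → suc n × 1# ≈ 1# + n × 1#
  suc×1# = ×-homo-+ 1# 1

  fromℤ-neg+ : ∀ n → fromℤ (ℤ.- + n) ≈ - (n × 1#)
  fromℤ-neg+ zero    = sym -0#≈0#
  fromℤ-neg+ (suc n) = refl

  fromℤ-neg : ∀ i → fromℤ (ℤ.- i) ≈ - fromℤ i
  fromℤ-neg (+ n)    = fromℤ-neg+ n
  fromℤ-neg -[1+ n ] = sym (-‿involutive _)

  1+x-[1+y]≈x-y : ∀ x y → (1# + x) - (1# + y) ≈ x - y
  1+x-[1+y]≈x-y x y = begin
    (1# + x) + - (1# + y)   ≈⟨ +-congˡ (⁻¹-∙-comm 1# y) ⟨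
    (1# + x) + (- 1# + - y) ≈⟨ +-congʳ (+-comm 1# x) ⟩
    (x + 1#) + (- 1# + - y) ≈⟨ +-assoc x 1# _ ⟩
    x + (1# + (- 1# + - y)) ≈⟨ +-congˡ (+-assoc 1# (- 1#) (- y)) ⟨
    x + ((1# - 1#) + - y)   ≈⟨ +-congˡ (+-congʳ (-‿inverseʳ 1#)) ⟩
    x + (0# + - y)          ≈⟨ +-congˡ (+-identityˡ _) ⟩
    x - y                   ∎

  fromℤ-⊖ : ∀ m n → fromℤ (m ℤ.⊖ n) ≈ m × 1# - n × 1#
  fromℤ-⊖ m       zero    = sym (trans (+-congˡ -0#≈0#) (+-identityʳ _))
  fromℤ-⊖ zero    (suc n) = sym (+-identityˡ _)
  fromℤ-⊖ (suc m) (suc n) = begin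
    fromℤ (suc m ℤ.⊖ suc n)        ≡⟨ ≡.cong fromℤ (ℤP.[1+m]⊖[1+n]≡m⊖n m n) ⟩
    fromℤ (m ℤ.⊖ n)                ≈⟨ fromℤ-⊖ m n ⟩
    m × 1# - n × 1#                ≈⟨ 1+x-[1+y]≈x-y _ _ ⟨
    (1# + m × 1#) - (1# + n × 1#)  ≈⟨ +-cong (suc×1# m) (-‿cong (suc×1# n)) ⟨
    suc m × 1# - suc n × 1#        ∎

  fromℤ-+ : ∀ i j → fromℤ (i ℤ.+ j) ≈ fromℤ i + fromℤ j
  fromℤ-+ (+ m)    (+ n)    = ×-homo-+ 1# m n
  fromℤ-+ (+ m)    -[1+ n ] = fromℤ-⊖ m (suc n)
  fromℤ-+ -[1+ m ] (+ n)    = trans (fromℤ-⊖ n (suc m)) (+-comm _ _)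
  fromℤ-+ -[1+ m ] -[1+ n ] = begin
    - (suc (suc m ℕ.+ n) × 1#)          ≡⟨ ≡.cong (λ k → - (k × 1#)) (ℕP.+-suc (suc m) n) ⟨
    - ((suc m ℕ.+ suc n) × 1#)          ≈⟨ -‿cong (×-homo-+ 1# (suc m) (suc n)) ⟩
    - (suc m × 1# + suc n × 1#)         ≈⟨ ⁻¹-∙-comm _ _ ⟨
    - (suc m × 1#) + - (suc n × 1#)     ∎

  fromℤ-* : ∀ i j → fromℤ (i ℤ.* j) ≈ fromℤ i * fromℤ j
  fromℤ-* (+ m) (+ n) = begin
    fromℤ (Sign.+ ℤ.◃ m ℕ.* n)  ≡⟨ ≡.cong fromℤ (ℤP.+◃n≡+n (m ℕ.* n)) ⟩
    (m ℕ.* n) × 1#              ≈⟨ ×1-homo-* m n ⟩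
    m × 1# * n × 1#             ∎
  fromℤ-* (+ m) -[1+ n ] = begin
    fromℤ (Sign.- ℤ.◃ m ℕ.* suc n)  ≡⟨ ≡.cong fromℤ (ℤP.-◃n≡-n (m ℕ.* suc n)) ⟩
    fromℤ (ℤ.- + (m ℕ.* suc n))     ≈⟨ fromℤ-neg+ (m ℕ.* suc n) ⟩
    - ((m ℕ.* suc n) × 1#)          ≈⟨ -‿cong (×1-homo-* m (suc n)) ⟩
    - (m × 1# * suc n × 1#)         ≈⟨ -‿distribʳ-* _ _ ⟩
    m × 1# * - (suc n × 1#)         ∎
  fromℤ-* -[1+ m ] (+ n) = begin
    fromℤ (Sign.- ℤ.◃ suc m ℕ.* n)  ≡⟨ ≡.cong fromℤ (ℤP.-◃n≡-n (suc m ℕ.* n)) ⟩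
    fromℤ (ℤ.- + (suc m ℕ.* n))     ≈⟨ fromℤ-neg+ (suc m ℕ.* n) ⟩
    - ((suc m ℕ.* n) × 1#)          ≈⟨ -‿cong (×1-homo-* (suc m) n) ⟩
    - (suc m × 1# * n × 1#)         ≈⟨ -‿distribˡ-* _ _ ⟩
    - (suc m × 1#) * n × 1#         ∎
  fromℤ-* -[1+ m ] -[1+ n ] = begin
    (suc m ℕ.* suc n) × 1#              ≈⟨ ×1-homo-* (suc m) (suc n) ⟩
    suc m × 1# * suc n × 1#             ≈⟨ -‿involutive _ ⟨
    - - (suc m × 1# * suc n × 1#)       ≈⟨ -‿cong (-‿distribˡ-* _ _) ⟩
    - (- (suc m × 1#) * suc n × 1#)     ≈⟨ -‿distribʳ-* _ _ ⟩
    - (suc m × 1#) * - (suc n × 1#)     ∎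

module IntegerRingSolver {c ℓ} (R : CommutativeRing c ℓ) where
  open CommutativeRing R
  open FromInteger ring using (fromℤ; fromℤ-+; fromℤ-*; fromℤ-neg)
  open import Algebra.Solver.Ring.AlmostCommutativeRing
    using (fromCommutativeRing; _-Raw-AlmostCommutative⟶_)

  fromℤ-morphism : ℤ.+-*-rawRing -Raw-AlmostCommutative⟶ fromCommutativeRing R
  fromℤ-morphism = record
    { ⟦_⟧    = fromℤ
    ; +-homo = fromℤ-+
    ; *-homo = fromℤ-*
    ; -‿homo = fromℤ-neg
    ; 0-homo = refl
    ; 1-homo = refl
    }

  fromℤ-≟ : ∀ i j → Maybe (fromℤ i ≈ fromℤ j)
  fromℤ-≟ i j with i ℤ.≟ j
  ... | yes ≡.refl = just refl
  ... | no _       = nothing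

  -- Normal forms are compared by refl, so the coefficients must compute: they are integers,
  -- interpreted in R through fromℤ.
  open import Algebra.Solver.Ring ℤ.+-*-rawRing (fromCommutativeRing R) fromℤ-morphism fromℤ-≟ public

i-1-1≡i-2 : ∀ i → i ℤ.- + 1 ℤ.- + 1 ≡ i ℤ.- + 2
i-1-1≡i-2 = solve-∀

i-1+1≡i : ∀ i → i ℤ.- + 1 ℤ.+ + 1 ≡ i
i-1+1≡i = solve-∀

i-1+2≡i+1 : ∀ i → i ℤ.- + 1 ℤ.+ + 2 ≡ i ℤ.+ + 1
i-1+2≡i+1 = solve-∀

module TripleProductSums {c ℓ} (R : CommutativeRing c ℓ) where
  open CommutativeRing R
  open IntegerRingSolver R using (solve; _:=_; con; _:+_; _:*_; _:-_)
  open import Relation.Binary.Reasoning.Setoid setoid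
  open import Algebra.Properties.CommutativeSemigroup *-commutativeSemigroup using (x∙yz≈y∙xz)

  three six : Carrier
  three = 1# + 1# + 1#
  six   = three + three

  genFib-shift : ∀ {X} → IsGenFib R X → ∀ j → IsGenFib R (λ i → X (j ℤ.+ i))
  genFib-shift {X} fib j i = begin
    X (j ℤ.+ (i ℤ.+ + 2))                    ≡⟨ ≡.cong X (ℤP.+-assoc j i (+ 2)) ⟨
    X (j ℤ.+ i ℤ.+ + 2)                      ≈⟨ fib (j ℤ.+ i) ⟩
    X (j ℤ.+ i ℤ.+ + 1) + X (j ℤ.+ i)        ≡⟨ ≡.cong (λ k → X k + X (j ℤ.+ i)) (ℤP.+-assoc j i (+ 1)) ⟩
    X (j ℤ.+ (i ℤ.+ + 1)) + X (j ℤ.+ i)      ∎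

  IsTripleProductRecurrent : (ℤ → Carrier) → Set ℓ
  IsTripleProductRecurrent T = ∀ i →
    T (i ℤ.+ + 2) ≈ three * T (i ℤ.+ + 1) + six * T i - three * T (i ℤ.- + 1) - T (i ℤ.- + 2)

  module GenFibWindow {X : ℤ → Carrier} (fib : IsGenFib R X) (i : ℤ) where
    private
      Y : ℤ → Carrier
      Y k = X (i ℤ.+ k)
      fibY : IsGenFib R Y
      fibY = genFib-shift fib i

    a b : Carrier
    a = X (i ℤ.- + 2)
    b = X (i ℤ.- + 1)

    at0 : X i ≈ b + a
    at0 = trans (reflexive (≡.cong X (≡.sym (ℤP.+-identityʳ i)))) (fibY -[1+ 1 ])

    at1 : X (i ℤ.+ + 1) ≈ (b + a) + b
    at1 = trans (fibY -[1+ 0 ]) (+-congʳ (trans (reflexive (≡.cong X (ℤP.+-identityʳ i))) at0))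

    at2 : X (i ℤ.+ + 2) ≈ ((b + a) + b) + (b + a)
    at2 = trans (fibY (+ 0)) (+-cong at1 (trans (reflexive (≡.cong X (ℤP.+-identityʳ i))) at0))

  tripleProduct-window : ∀ a b c d e f →
    (((b + a) + b) + (b + a)) * (((d + c) + d) + (d + c)) * (((f + e) + f) + (f + e))
      ≈ three * (((b + a) + b) * ((d + c) + d) * ((f + e) + f)) + six * ((b + a) * (d + c) * (f + e))
        - three * (b * d * f) - a * c * e
  tripleProduct-window = solve 6 (λ a b c d e f →
    let three = con (+ 1) :+ con (+ 1) :+ con (+ 1) in
    (((b :+ a) :+ b) :+ (b :+ a)) :* (((d :+ c) :+ d) :+ (d :+ c)) :* (((f :+ e) :+ f) :+ (f :+ e))
      := three :* (((b :+ a) :+ b) :* ((d :+ c) :+ d) :* ((f :+ e) :+ f))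
         :+ (three :+ three) :* ((b :+ a) :* (d :+ c) :* (f :+ e))
         :- three :* (b :* d :* f) :- a :* c :* e) refl

  tripleProduct-recurrent : ∀ {G H K} → IsGenFib R G → IsGenFib R H → IsGenFib R K →
                            IsTripleProductRecurrent (λ i → G i * H i * K i)
  tripleProduct-recurrent {G} {H} {K} fibG fibH fibK i = begin
    G (i ℤ.+ + 2) * H (i ℤ.+ + 2) * K (i ℤ.+ + 2)
      ≈⟨ *-cong (*-cong g.at2 h.at2) k.at2 ⟩
    _ ≈⟨ tripleProduct-window g.a g.b h.a h.b k.a k.b ⟩
    _ ≈⟨ +-congʳ (+-congʳ (+-cong (*-congˡ (*-cong (*-cong g.at1 h.at1) k.at1))
                                  (*-congˡ (*-cong (*-cong g.at0 h.at0) k.at0)))) ⟨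
    three * (G (i ℤ.+ + 1) * H (i ℤ.+ + 1) * K (i ℤ.+ + 1)) + six * (G i * H i * K i)
      - three * (g.b * h.b * k.b) - g.a * h.a * k.a ∎
    where
    module g = GenFibWindow fibG i
    module h = GenFibWindow fibH i
    module k = GenFibWindow fibK i

  denominator : Carrier → Carrier
  denominator x = (1# + x - x * x) * (1# - (1# + 1# + 1# + 1#) * x - x * x)

  boundaryForm : Carrier → Carrier → Carrier → Carrier → Carrier → Carrier
  boundaryForm x t₋₁ t₀ t₁ t₂ = x * x * (x + three) * t₀ + (three * x - 1#) * t₁ + x * x * t₋₁ - x * t₂

  boundaryForm-cong : ∀ x {t₋₁ u₋₁ t₀ u₀ t₁ u₁ t₂ u₂} → t₋₁ ≈ u₋₁ → t₀ ≈ u₀ → t₁ ≈ u₁ → t₂ ≈ u₂ →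
                      boundaryForm x t₋₁ t₀ t₁ t₂ ≈ boundaryForm x u₋₁ u₀ u₁ u₂
  boundaryForm-cong x e₋₁ e₀ e₁ e₂ =
    +-cong (+-cong (+-cong (*-congˡ e₀) (*-congˡ e₁)) (*-congˡ e₋₁)) (-‿cong (*-congˡ e₂))

  boundary : Carrier → (ℤ → Carrier) → ℤ → Carrier
  boundary x T i = boundaryForm x (T (i ℤ.- + 1)) (T i) (T (i ℤ.+ + 1)) (T (i ℤ.+ + 2))

  denominator-boundaryForm : ∀ x t₋₂ t₋₁ t₀ t₁ →
    denominator x * t₀
      ≈ x * boundaryForm x t₋₁ t₀ t₁ (three * t₁ + six * t₀ - three * t₋₁ - t₋₂)
        - boundaryForm x t₋₂ t₋₁ t₀ t₁
  denominator-boundaryForm = solve 5 (λ x t₋₂ t₋₁ t₀ t₁ →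
    let one = con (+ 1) ; three = one :+ one :+ one
        W : _ → _ → _ → _ → _
        W s₋₁ s₀ s₁ s₂ = x :* x :* (x :+ three) :* s₀ :+ (three :* x :- one) :* s₁ :+ x :* x :* s₋₁ :- x :* s₂
    in (one :+ x :- x :* x) :* (one :- (one :+ one :+ one :+ one) :* x :- x :* x) :* t₀
       := x :* W t₋₁ t₀ t₁ (three :* t₁ :+ (three :+ three) :* t₀ :- three :* t₋₁ :- t₋₂)
          :- W t₋₂ t₋₁ t₀ t₁) refl

  boundary-difference : ∀ {T} → IsTripleProductRecurrent T → ∀ x i →
    denominator x * T i ≈ x * boundary x T i - boundary x T (i ℤ.- + 1)
  boundary-difference {T} rec x i = begin
    denominator x * T i
      ≈⟨ denominator-boundaryForm x (T (i ℤ.- + 2)) (T (i ℤ.- + 1)) (T i) (T (i ℤ.+ + 1)) ⟩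
    x * boundaryForm x _ _ _ _ - boundaryForm x (T (i ℤ.- + 2)) (T (i ℤ.- + 1)) (T i) (T (i ℤ.+ + 1))
      ≈⟨ +-cong (*-congˡ (boundaryForm-cong x refl refl refl (rec i)))
                (-‿cong (boundaryForm-cong x (T-cong (i-1-1≡i-2 i)) refl (T-cong (i-1+1≡i i)) (T-cong (i-1+2≡i+1 i)))) ⟨
    x * boundary x T i - boundary x T (i ℤ.- + 1) ∎
    where
    T-cong : ∀ {j k} → j ≡ k → T j ≈ T k
    T-cong = reflexive ∘ ≡.cong T

  sumTo-telescoping : ∀ (d : Carrier) (f V : ℕ → Carrier) → (∀ k → d * f k ≈ V (suc k) - V k) →
                      ∀ n → d * sumTo R f n ≈ V (suc n) - V 0
  sumTo-telescoping d f V step zero    = step 0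
  sumTo-telescoping d f V step (suc n) = begin
    d * (sumTo R f n + f (suc n))                      ≈⟨ distribˡ d _ _ ⟩
    d * sumTo R f n + d * f (suc n)                    ≈⟨ +-cong (sumTo-telescoping d f V step n) (step (suc n)) ⟩
    (V (suc n) - V 0) + (V (suc (suc n)) - V (suc n))  ≈⟨ collapse (V 0) (V (suc n)) (V (suc (suc n))) ⟩
    V (suc (suc n)) - V 0                              ∎
    where
    collapse : ∀ u v w → (v - u) + (w - v) ≈ w - u
    collapse = solve 3 (λ u v w → (v :- u) :+ (w :- v) := w :- u) refl

  weighted-boundary-difference : ∀ {T} → IsTripleProductRecurrent T → ∀ x k →
    denominator x * (pow R x k * T (+ k))
      ≈ pow R x (suc k) * boundary x T (+ k) - pow R x k * boundary x T (+ k ℤ.- + 1)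
  weighted-boundary-difference {T} rec x k = begin
    denominator x * (y * T (+ k))          ≈⟨ x∙yz≈y∙xz (denominator x) y (T (+ k)) ⟩
    y * (denominator x * T (+ k))          ≈⟨ *-congˡ (boundary-difference rec x (+ k)) ⟩
    y * (x * boundary x T (+ k) - b)       ≈⟨ distribute y x (boundary x T (+ k)) b ⟩
    x * y * boundary x T (+ k) - y * b     ∎
    where
    y b : Carrier
    y = pow R x k
    b = boundary x T (+ k ℤ.- + 1)
    distribute : ∀ y x u v → y * (x * u - v) ≈ x * y * u - y * v
    distribute = solve 4 (λ y x u v → y :* (x :* u :- v) := x :* y :* u :- y :* v) refl

  weightedSum-closedForm : ∀ {T} → IsTripleProductRecurrent T → ∀ x n →
    denominator x * sumTo R (λ k → pow R x k * T (+ k)) n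
      ≈ pow R x (suc n) * boundary x T (+ n) - 1# * boundary x T -[1+ 0 ]
  -- The telescoped sequence is V k = x^k B (k - 1); V (suc k) is x^(k+1) B k because
  -- + suc k - + 1 reduces to + k.
  weightedSum-closedForm {T} rec x =
    sumTo-telescoping (denominator x) _ (λ k → pow R x k * boundary x T (+ k ℤ.- + 1))
                      (weighted-boundary-difference rec x)

  d*s≈e⇒s≈u*e : ∀ {u d s e} → u * d ≈ 1# → d * s ≈ e → s ≈ u * e
  d*s≈e⇒s≈u*e {u} {d} {s} {e} ud≈1 ds≈e = begin
    s            ≈⟨ *-identityˡ s ⟨
    1# * s       ≈⟨ *-congʳ ud≈1 ⟨
    u * d * s    ≈⟨ *-assoc u d s ⟩
    u * (d * s)  ≈⟨ *-congˡ ds≈e ⟩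
    u * e        ∎

  expand-boundary : ∀ a c₁ c₂ c₃ c₄ → a - 1# * (c₁ + c₂ + c₃ - c₄) ≈ a - c₁ - c₂ - c₃ + c₄
  expand-boundary = solve 5 (λ a c₁ c₂ c₃ c₄ →
    a :- con (+ 1) :* (c₁ :+ c₂ :+ c₃ :- c₄) := a :- c₁ :- c₂ :- c₃ :+ c₄) refl

mainTheorem7 : ∀ {c ℓ} (R : CommutativeRing c ℓ) →
  let open CommutativeRing R in
  (G H K : ℤ → Carrier) → IsGenFib R G → IsGenFib R H → IsGenFib R K →
  (p q r : ℤ) (n : ℕ) (x dinv : Carrier) →
  dinv * ((1# + x - x * x) * (1# - (1# + 1# + 1# + 1#) * x - x * x)) ≈ 1# →
  let T : ℤ → Carrier
      T i = G (p ℤ.+ i) * H (q ℤ.+ i) * K (r ℤ.+ i)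
      N : ℤ
      N = + n
      three = 1# + 1# + 1#
  in
  sumTo R (λ k → pow R x k * T (+ k)) n
    ≈ dinv * (pow R x (ℕ.suc n)
                * (x * x * (x + three) * T N
                   + (three * x - 1#) * T (N ℤ.+ + 1)
                   + x * x * T (N ℤ.- + 1)
                   - x * T (N ℤ.+ + 2))
              - x * x * (x + three) * T -[1+ 0 ]
              - (three * x - 1#) * T (+ 0)
              - x * x * T -[1+ 1 ]
              + x * T (+ 1))
mainTheorem7 R G H K fibG fibH fibK p q r n x dinv inv =
  trans (d*s≈e⇒s≈u*e inv (weightedSum-closedForm recurrent x n))
        (*-congˡ (expand-boundary _ _ _ _ _))
  where
  open CommutativeRing R
  open TripleProductSums R
  recurrent : IsTripleProductRecurrent (λ i → G (p ℤ.+ i) * H (q ℤ.+ i) * K (r ℤ.+ i))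
  recurrent = tripleProduct-recurrent (genFib-shift fibG p) (genFib-shift fibH q) (genFib-shift fibK r)
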